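{- For all derivations $\chi$ and $\zeta$ of ABC transitions, $\chi\smile^\bullet\zeta$ implies $\chi\not\equiv\zeta$.
   Context: ABC: sets $\mathcal A$ (agent identifiers), $\mathcal B$ (broadcast names), $\mathcal C$ (handshake names); $H=\mathcal C\cup\{\bar c\mid c\in\mathcal C\}$, $\bar{\bar c}=c$; $Act=\mathcal B!\cup\mathcal B?\cup H\cup\{\tau\}$ with $\mathcal B!=\{b!\}$, $\mathcal B?=\{b?\}$. A relabelling $f$ maps $\mathcal B\to\mathcal B$, $\mathcal C\to\mathcal C$, extended by $f(\bar c)=\overline{f(c)}$, $f(b\sharp)=f(b)\sharp$, $f(\tau)=\tau$. Expressions: $0$, $\alpha.E$, $E+F$, $E|F$, $E\backslash c$ ($c\in H$), $E[f]$, $A\in\mathcal A$ with guarded defining equations $A\stackrel{def}{=}P$. Transitions are given by the rules (with $\eta\in H\cup\{\tau\}$): (Act) $\alpha.E\xrightarrow{\alpha}E$; (Sum-l/r) a transition of $E$ (resp. $F$) is a transition of $E+F$; (Par-l/r) $E\xrightarrow{\eta}E'$ gives $E|F\xrightarrow{\eta}E'|F$, and symmetrically; (Comm) $E\xrightarrow{c}E'$, $F\xrightarrow{\bar c}F'$ give $E|F\xrightarrow{\tau}E'|F'$; (Bro-l) $E\xrightarrow{b\sharp_1}E'$ ($\sharp_1\in\{!,?\}$) and $F$ has no $b?$-transition give $E|F\xrightarrow{b\sharp_1}E'|F$; (Bro-r) symmetric; (Bro-c) $E\xrightarrow{b\sharp_1}E'$, $F\xrightarrow{b\sharp_2}F'$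 give $E|F\xrightarrow{b(\sharp_1\circ\sharp_2)}E'|F'$ with $!\circ?=?\circ!=!$, $?\circ?=?$, $!\circ!$ undefined; (Rel) $E\xrightarrow{\ell}E'$ gives $E[f]\xrightarrow{f(\ell)}E'[f]$; (Res) $E\xrightarrow{\ell}E'$, $\ell\notin\{c,\bar c\}$ give $E\backslash c\xrightarrow{\ell}E'\backslash c$; (Rec) $P\xrightarrow{\ell}E'$, $A\stackrel{def}{=}P$ give $A\xrightarrow{\ell}E'$. Derivations of transitions are named: $(\alpha\to P)$ for (Act); $\chi|\zeta$ for (Comm)/(Bro-c); $\chi|Q$ for (Par-l)/(Bro-l); $P|\zeta$ for (Par-r)/(Bro-r); $\chi{+}Q$, $P{+}\chi$, $\chi[f]$, $\chi\backslash c$, $A{:}\chi$ for (Sum-l), (Sum-r), (Rel), (Res), (Rec); $src,target,\ell$ give source, target, label. Concurrency $\smile^\bullet$ is the smallest relation on derivations such that (whenever the composed derivations exist): $\chi|Q\smile^\bullet P|\zeta$ and $P|\zeta\smile^\bullet\chi|Q$ if $src(\chi)=P$, $src(\zeta)=Q$; $\chi|\varsigma\smile^\bullet P|\zeta$ and $\varsigma|\chi\smile^\bullet\zeta|P$ if $src(\chi)=P$, $src(\varsigma)=src(\zeta)$, $\ell(\varsigma)\in\mathcal B?$; $\chi\smile^\bullet\zeta$ implies $\chi{+}P\smile^\bullet\zeta{+}P$, $P{+}\chi\smile^\bullet P{+}\zeta$, $\chi|P\smile^\bullet\zeta|P$, $P|\chi\smile^\bullet P|\zeta$; $\chi\smile^\bullet\zeta$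 implies $\chi|P\smile^\bullet\zeta|\xi$, $\chi|\xi\smile^\bullet\zeta|P$, $P|\chi\smile^\bullet\xi|\zeta$, $\xi|\chi\smile^\bullet P|\zeta$ if $P=src(\xi)$; $\chi\smile^\bullet\zeta$ implies $\chi|\varsigma\smile^\bullet\zeta|\xi$ and $\varsigma|\chi\smile^\bullet\xi|\zeta$ if $src(\varsigma)=src(\xi)$, $\ell(\varsigma)\in\mathcal B?$; $\chi\smile^\bullet\zeta$ and $\varsigma\smile^\bullet\xi$ imply $\chi|\varsigma\smile^\bullet\zeta|\xi$; $\chi\smile^\bullet\zeta$ implies $\chi\backslash c\smile^\bullet\zeta\backslash c$, $\chi[f]\smile^\bullet\zeta[f]$, $A{:}\chi\smile^\bullet A{:}\zeta$. $\equiv$ is the smallest equivalence relation on derivations $\chi$ with $\ell(\chi)\notin\mathcal B?$ such that (whenever derivations exist): $\chi|P\equiv\chi|Q$, $P|\chi\equiv Q|\chi$; $\chi|\varsigma\equiv\chi|P$, $\varsigma|\chi\equiv P|\chi$ if $\ell(\chi)\in\mathcal B!$; $\chi{+}P\equiv\chi\equiv P{+}\chi$, $A{:}\chi\equiv\chi$; $\chi\equiv\zeta$ implies $\chi\backslash c\equiv\zeta\backslash c$, $\chi[f]\equiv\zeta[f]$, $\chi|P\equiv\zeta|P$, $P|\chi\equiv P|\zeta$; $\chi\equiv\zeta$ and $\varsigma\equiv\xi$ imply $\chi|\varsigma\equiv\zeta|\xi$. (Derivations with labels in $\mathcal B?$ are not related by $\equiv$.) -}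

-- Parameterised by the sets 𝒜 (agent identifiers), ℬ (broadcast names),
-- 𝒞 (handshake names).
module Defs where

module ABC (𝒜 ℬ 𝒞 : Set) where

  open import Data.Product using (Σ; _×_; _,_)
  open import Data.Unit using (⊤)
  open import Data.Empty using (⊥)
  open import Relation.Nullary using (¬_)
  open import Relation.Binary.PropositionalEquality using (_≡_; _≢_)

  data H : Set where
    nm  : 𝒞 → H
    co  : 𝒞 → H

  bar : H → H
  bar (nm c) = co c
  bar (co c) = nm c

  -- Act = ℬ! ∪ ℬ? ∪ H ∪ {τ}  (also used as the set of transition labels)
  data Act : Set where
    _¡  : ℬ → Act
    _¿  : ℬ → Act
    hs  : H → Act
    τ   : Act

  IsRcv : Act → Set
  IsRcv (b ¿) = ⊤
  IsRcv _     = ⊥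

  IsSnd : Act → Set
  IsSnd (b ¡) = ⊤
  IsSnd _     = ⊥

  record Relab : Set where
    constructor relab
    field
      fB : ℬ → ℬ
      fC : 𝒞 → 𝒞
  open Relab public

  relabH : Relab → H → H
  relabH f (nm c) = nm (fC f c)
  relabH f (co c) = co (fC f c)

  relabel : Relab → Act → Act
  relabel f (b ¡)  = fB f b ¡
  relabel f (b ¿)  = fB f b ¿
  relabel f (hs h) = hs (relabH f h)
  relabel f τ      = τ

  infixr 20 _∙_
  infixl 15 _⊕_
  infixl 14 _∥_
  data Expr : Set where
    𝟎     : Expr
    _∙_   : Act → Expr → Expr
    _⊕_   : Expr → Expr → Expr
    _∥_   : Expr → Expr → Expr
    _∖_   : Expr → H → Expr
    _[_]  : Expr → Relab → Expr
    var   : 𝒜 → Expr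

  Guarded : Expr → Set
  Guarded 𝟎       = ⊤
  Guarded (α ∙ E) = ⊤
  Guarded (E ⊕ F) = Guarded E × Guarded F
  Guarded (E ∥ F) = Guarded E × Guarded F
  Guarded (E ∖ c) = Guarded E
  Guarded (E [ f ]) = Guarded E
  Guarded (var A) = ⊥

  -- Semantics relative to the defining equations A ≝ Δ A
  module Semantics (Δ : 𝒜 → Expr) where

    -- HasRcv E b : E has some b?-transition.  (Inductive characterisation of
    -- "∃ E'. E -b?→ E'" read off from the rules: only Act, Sum, Bro-l/r/c,
    -- Rel, Res, Rec can produce ℬ? labels.)
    data HasRcv : Expr → ℬ → Set where
      act  : ∀ {b E} → HasRcv ((b ¿) ∙ E) b
      sumˡ : ∀ {E F b} → HasRcv E b → HasRcv (E ⊕ F) b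
      sumʳ : ∀ {E F b} → HasRcv F b → HasRcv (E ⊕ F) b
      parˡ : ∀ {E F b} → HasRcv E b → HasRcv (E ∥ F) b
      parʳ : ∀ {E F b} → HasRcv F b → HasRcv (E ∥ F) b
      rel  : ∀ {E f b} → HasRcv E b → HasRcv (E [ f ]) (fB f b)
      res  : ∀ {E c b} → HasRcv E b → HasRcv (E ∖ c) b
      rec  : ∀ {A b} → HasRcv (Δ A) b → HasRcv (var A) b

    -- side condition for (Par-l)/(Bro-l) with the other component Q:
    -- either ℓ = η ∈ H ∪ {τ}, or ℓ = b♯ and Q has no b?-transition.
    data SideOK : Act → Expr → Set where
      η-hs  : ∀ {h Q} → SideOK (hs h) Q
      η-τ   : ∀ {Q} → SideOK τ Q
      bro-! : ∀ {b Q} → ¬ HasRcv Q b → SideOK (b ¡) Q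
      bro-? : ∀ {b Q} → ¬ HasRcv Q b → SideOK (b ¿) Q

    data Sync : Act → Act → Act → Set where
      comm : ∀ h → Sync (hs h) (hs (bar h)) τ
      !? : ∀ b → Sync (b ¡) (b ¿) (b ¡)
      ?! : ∀ b → Sync (b ¿) (b ¡) (b ¡)
      ?? : ∀ b → Sync (b ¿) (b ¿) (b ¿)

    data Der : Expr → Act → Expr → Set where
      act   : (α : Act) (P : Expr) → Der (α ∙ P) α P
      sumˡ  : ∀ {E ℓ E'} → Der E ℓ E' → (Q : Expr) → Der (E ⊕ Q) ℓ E'
      sumʳ  : ∀ {F ℓ F'} → (P : Expr) → Der F ℓ F' → Der (P ⊕ F) ℓ F'
      -- χ | Q   (Par-l, Bro-l)
      parˡ  : ∀ {E ℓ E'} → Der E ℓ E' → (Q : Expr) → SideOK ℓ Q →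
              Der (E ∥ Q) ℓ (E' ∥ Q)
      -- P | ζ   (Par-r, Bro-r)
      parʳ  : ∀ {F ℓ F'} → (P : Expr) → Der F ℓ F' → SideOK ℓ P →
              Der (P ∥ F) ℓ (P ∥ F')
      -- χ | ζ   (Comm, Bro-c)
      sync  : ∀ {E ℓ₁ E' F ℓ₂ F' ℓ} → Der E ℓ₁ E' → Der F ℓ₂ F' →
              Sync ℓ₁ ℓ₂ ℓ → Der (E ∥ F) ℓ (E' ∥ F')
      rel   : ∀ {E ℓ E'} → Der E ℓ E' → (f : Relab) →
              Der (E [ f ]) (relabel f ℓ) (E' [ f ])
      res   : ∀ {E ℓ E'} → Der E ℓ E' → (c : H) → ℓ ≢ hs c → ℓ ≢ hs (bar c) →
              Der (E ∖ c) ℓ (E' ∖ c)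
      rec   : ∀ {ℓ E'} → (A : 𝒜) → Der (Δ A) ℓ E' → Der (var A) ℓ E'

    data _⌣_ : ∀ {P ℓ P' Q ℓ' Q'} → Der P ℓ P' → Der Q ℓ' Q' → Set where
      lr  : ∀ {P ℓ P' Q ℓ' Q'} (χ : Der P ℓ P') (ζ : Der Q ℓ' Q') p q →
            parˡ χ Q p ⌣ parʳ P ζ q
      rl  : ∀ {P ℓ P' Q ℓ' Q'} (χ : Der P ℓ P') (ζ : Der Q ℓ' Q') p q →
            parʳ P ζ q ⌣ parˡ χ Q p
      sr  : ∀ {P ℓ P' Q b Q₁ ℓ₂ ℓ' Q₂} (χ : Der P ℓ P') (ς : Der Q (b ¿) Q₁)
              (ζ : Der Q ℓ' Q₂) (s : Sync ℓ (b ¿) ℓ₂) q →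
            sync χ ς s ⌣ parʳ P ζ q
      sl  : ∀ {P ℓ P' Q b Q₁ ℓ₂ ℓ' Q₂} (χ : Der P ℓ P') (ς : Der Q (b ¿) Q₁)
              (ζ : Der Q ℓ' Q₂) (s : Sync (b ¿) ℓ ℓ₂) q →
            sync ς χ s ⌣ parˡ ζ P q
      sumˡ : ∀ {E ℓ E' F ℓ' F'} {χ : Der E ℓ E'} {ζ : Der F ℓ' F'} (P : Expr) →
             χ ⌣ ζ → sumˡ χ P ⌣ sumˡ ζ P
      sumʳ : ∀ {E ℓ E' F ℓ' F'} {χ : Der E ℓ E'} {ζ : Der F ℓ' F'} (P : Expr) →
             χ ⌣ ζ → sumʳ P χ ⌣ sumʳ P ζ
      parˡ : ∀ {E ℓ E' F ℓ' F'} {χ : Der E ℓ E'} {ζ : Der F ℓ' F'} (P : Expr) p q →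
             χ ⌣ ζ → parˡ χ P p ⌣ parˡ ζ P q
      parʳ : ∀ {E ℓ E' F ℓ' F'} {χ : Der E ℓ E'} {ζ : Der F ℓ' F'} (P : Expr) p q →
             χ ⌣ ζ → parʳ P χ p ⌣ parʳ P ζ q
      l-s  : ∀ {E ℓ E' F ℓ' F' P ℓ₁ P' ℓ₂} {χ : Der E ℓ E'} {ζ : Der F ℓ' F'}
               (ξ : Der P ℓ₁ P') p (s : Sync ℓ' ℓ₁ ℓ₂) →
             χ ⌣ ζ → parˡ χ P p ⌣ sync ζ ξ s
      s-l  : ∀ {E ℓ E' F ℓ' F' P ℓ₁ P' ℓ₂} {χ : Der E ℓ E'} {ζ : Der F ℓ' F'}
               (ξ : Der P ℓ₁ P') (s : Sync ℓ ℓ₁ ℓ₂) p →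
             χ ⌣ ζ → sync χ ξ s ⌣ parˡ ζ P p
      r-s  : ∀ {E ℓ E' F ℓ' F' P ℓ₁ P' ℓ₂} {χ : Der E ℓ E'} {ζ : Der F ℓ' F'}
               (ξ : Der P ℓ₁ P') p (s : Sync ℓ₁ ℓ' ℓ₂) →
             χ ⌣ ζ → parʳ P χ p ⌣ sync ξ ζ s
      s-r  : ∀ {E ℓ E' F ℓ' F' P ℓ₁ P' ℓ₂} {χ : Der E ℓ E'} {ζ : Der F ℓ' F'}
               (ξ : Der P ℓ₁ P') (s : Sync ℓ₁ ℓ ℓ₂) p →
             χ ⌣ ζ → sync ξ χ s ⌣ parʳ P ζ p
      s-sˡ : ∀ {E ℓ E' F ℓ' F' Q b Q₁ ℓ₁ Q₂ ℓ₂ ℓ₃} {χ : Der E ℓ E'} {ζ : Der F ℓ' F'}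
               (ς : Der Q (b ¿) Q₁) (ξ : Der Q ℓ₁ Q₂)
               (s : Sync ℓ (b ¿) ℓ₂) (t : Sync ℓ' ℓ₁ ℓ₃) →
             χ ⌣ ζ → sync χ ς s ⌣ sync ζ ξ t
      s-sʳ : ∀ {E ℓ E' F ℓ' F' Q b Q₁ ℓ₁ Q₂ ℓ₂ ℓ₃} {χ : Der E ℓ E'} {ζ : Der F ℓ' F'}
               (ς : Der Q (b ¿) Q₁) (ξ : Der Q ℓ₁ Q₂)
               (s : Sync (b ¿) ℓ ℓ₂) (t : Sync ℓ₁ ℓ' ℓ₃) →
             χ ⌣ ζ → sync ς χ s ⌣ sync ξ ζ t
      s-s  : ∀ {E ℓ E' F ℓ' F' G ℓ₁ G' K ℓ₂ K' ℓ₃ ℓ₄}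
               {χ : Der E ℓ E'} {ζ : Der F ℓ' F'} {ς : Der G ℓ₁ G'} {ξ : Der K ℓ₂ K'}
               (s : Sync ℓ ℓ₁ ℓ₃) (t : Sync ℓ' ℓ₂ ℓ₄) →
             χ ⌣ ζ → ς ⌣ ξ → sync χ ς s ⌣ sync ζ ξ t
      res  : ∀ {E ℓ E' F ℓ' F'} {χ : Der E ℓ E'} {ζ : Der F ℓ' F'} (c : H) p p' q q' →
             χ ⌣ ζ → res χ c p p' ⌣ res ζ c q q'
      rel  : ∀ {E ℓ E' F ℓ' F'} {χ : Der E ℓ E'} {ζ : Der F ℓ' F'} (f : Relab) →
             χ ⌣ ζ → rel χ f ⌣ rel ζ f
      rec  : ∀ {ℓ E' ℓ' F'} (A : 𝒜) {χ : Der (Δ A) ℓ E'} {ζ : Der (Δ A) ℓ' F'} →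
             χ ⌣ ζ → rec A χ ⌣ rec A ζ

    -- The equivalence ≡ on derivations with labels not in ℬ?
    data _≋_ : ∀ {P ℓ P' Q ℓ' Q'} → Der P ℓ P' → Der Q ℓ' Q' → Set where
      ≋-refl  : ∀ {P ℓ P'} (χ : Der P ℓ P') → ¬ IsRcv ℓ → χ ≋ χ
      ≋-sym   : ∀ {P ℓ P' Q ℓ' Q'} {χ : Der P ℓ P'} {ζ : Der Q ℓ' Q'} →
                χ ≋ ζ → ζ ≋ χ
      ≋-trans : ∀ {P ℓ P' Q ℓ' Q' R ℓ'' R'}
                  {χ : Der P ℓ P'} {ζ : Der Q ℓ' Q'} {ξ : Der R ℓ'' R'} →
                χ ≋ ζ → ζ ≋ ξ → χ ≋ ξ
      parˡ-any : ∀ {E ℓ E'} (χ : Der E ℓ E') P Q p q → ¬ IsRcv ℓ →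
                 parˡ χ P p ≋ parˡ χ Q q
      parʳ-any : ∀ {E ℓ E'} (χ : Der E ℓ E') P Q p q → ¬ IsRcv ℓ →
                 parʳ P χ p ≋ parʳ Q χ q
      sync-parˡ : ∀ {E ℓ E' F ℓ₁ F' ℓ₂} (χ : Der E ℓ E') (ς : Der F ℓ₁ F')
                    (s : Sync ℓ ℓ₁ ℓ₂) P p → IsSnd ℓ →
                  sync χ ς s ≋ parˡ χ P p
      sync-parʳ : ∀ {E ℓ E' F ℓ₁ F' ℓ₂} (χ : Der E ℓ E') (ς : Der F ℓ₁ F')
                    (s : Sync ℓ₁ ℓ ℓ₂) P p → IsSnd ℓ →
                  sync ς χ s ≋ parʳ P χ p
      sumˡ-id : ∀ {E ℓ E'} (χ : Der E ℓ E') P → ¬ IsRcv ℓ → sumˡ χ P ≋ χ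
      sumʳ-id : ∀ {E ℓ E'} (χ : Der E ℓ E') P → ¬ IsRcv ℓ → sumʳ P χ ≋ χ
      rec-id  : ∀ {ℓ E'} (A : 𝒜) (χ : Der (Δ A) ℓ E') → ¬ IsRcv ℓ → rec A χ ≋ χ
      res  : ∀ {E ℓ E' F ℓ' F'} {χ : Der E ℓ E'} {ζ : Der F ℓ' F'} (c : H) p p' q q' →
             χ ≋ ζ → res χ c p p' ≋ res ζ c q q'
      rel  : ∀ {E ℓ E' F ℓ' F'} {χ : Der E ℓ E'} {ζ : Der F ℓ' F'} (f : Relab) →
             χ ≋ ζ → rel χ f ≋ rel ζ f
      parˡ : ∀ {E ℓ E' F ℓ' F'} {χ : Der E ℓ E'} {ζ : Der F ℓ' F'} (P : Expr) p q →
             χ ≋ ζ → parˡ χ P p ≋ parˡ ζ P q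
      parʳ : ∀ {E ℓ E' F ℓ' F'} {χ : Der E ℓ E'} {ζ : Der F ℓ' F'} (P : Expr) p q →
             χ ≋ ζ → parʳ P χ p ≋ parʳ P ζ q
      sync : ∀ {E ℓ E' F ℓ' F' G ℓ₁ G' K ℓ₂ K' ℓ₃ ℓ₄}
               {χ : Der E ℓ E'} {ζ : Der F ℓ' F'} {ς : Der G ℓ₁ G'} {ξ : Der K ℓ₂ K'}
               (s : Sync ℓ ℓ₁ ℓ₃) (t : Sync ℓ' ℓ₂ ℓ₄) →
             χ ≋ ζ → ς ≋ ξ → sync χ ς s ≋ sync ζ ξ t

-- A derivation has a shape: the tree of parallel components taking part in its
-- transition, forgetting choice, restriction, relabelling and recursion, and
-- dropping a receiver that only listens to its partner's send.  Every generator
-- of ≡ preserves the shape (in χ|ς ≡ χ|P the derivation ς is such a listener),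
-- whereas concurrent derivations have apart shapes: at some parallel composition
-- one enters a component the other avoids, or both enter it with apart shapes.
-- Apartness is irreflexive, so concurrent derivations are never equivalent.
module Submission where

open import Data.Bool.Base using (Bool; true; false)
open import Data.Maybe.Base using (Maybe; just; nothing; when)
open import Data.Product.Base using (Σ; _,_; proj₁)
open import Relation.Binary.Definitions using (Irreflexive)
open import Relation.Binary.PropositionalEquality using (_≡_; refl; sym; trans; cong; cong₂)
open import Relation.Nullary using (¬_)
open import Defs

data Shape : Set where
  prefix : Shape
  node   : Maybe Shape → Maybe Shape → Shape

data _#_ : Shape → Shape → Set
data _#ᵐ_ : Maybe Shape → Maybe Shape → Set

data _#_ where
  left  : ∀ {a b a′ b′} → a #ᵐ a′ → node a b # node a′ b′
  right : ∀ {a b a′ b′} → b #ᵐ b′ → node a b # node a′ b′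

data _#ᵐ_ where
  just-nothing : ∀ {x} → just x #ᵐ nothing
  nothing-just : ∀ {y} → nothing #ᵐ just y
  just-just    : ∀ {x y} → x # y → just x #ᵐ just y

#-irrefl : Irreflexive _≡_ _#_
#ᵐ-irrefl : Irreflexive _≡_ _#ᵐ_

#-irrefl refl (left p)  = #ᵐ-irrefl refl p
#-irrefl refl (right p) = #ᵐ-irrefl refl p

#ᵐ-irrefl refl (just-just p) = #-irrefl refl p

just-#ᵐ-when : ∀ {x y} b → x # y → just x #ᵐ when b y
just-#ᵐ-when true  p = just-just p
just-#ᵐ-when false _ = just-nothing

when-#ᵐ-just : ∀ {x y} b → x # y → when b x #ᵐ just y
when-#ᵐ-just true  p = just-just p
when-#ᵐ-just false _ = nothing-just

module _ {𝒜 ℬ 𝒞 : Set} (Δ : 𝒜 → ABC.Expr 𝒜 ℬ 𝒞) where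
  open ABC 𝒜 ℬ 𝒞
  open Semantics Δ

  private variable
    a b c d ℓ ℓ′ : Act
    P P′ Q Q′ : Expr

  Sync-unique : (s : Sync a b c) (t : Sync a b d) →
                _≡_ {A = Σ Act (Sync a b)} (c , s) (d , t)
  Sync-unique (comm _) (comm _) = refl
  Sync-unique (!? _)   (!? _)   = refl
  Sync-unique (?! _)   (?! _)   = refl
  Sync-unique (?? _)   (?? _)   = refl

  activeˡ activeʳ : Sync a b c → Bool
  activeˡ (?! _) = false
  activeˡ _      = true
  activeʳ (!? _) = false
  activeʳ _      = true

  shape : Der P ℓ P′ → Shape
  shape (act _ _)      = prefix
  shape (sumˡ χ _)     = shape χ
  shape (sumʳ _ χ)     = shape χ
  shape (parˡ χ _ _)   = node (just (shape χ)) nothing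
  shape (parʳ _ χ _)   = node nothing (just (shape χ))
  shape (sync χ ς s)   = node (when (activeˡ s) (shape χ)) (when (activeʳ s) (shape ς))
  shape (rel χ _)      = shape χ
  shape (res χ _ _ _)  = shape χ
  shape (rec _ χ)      = shape χ

  ≋⇒≡label : {χ : Der P ℓ P′} {ζ : Der Q ℓ′ Q′} → χ ≋ ζ → ℓ ≡ ℓ′
  ≋⇒≡label (≋-refl _ _)                      = refl
  ≋⇒≡label (≋-sym e)                         = sym (≋⇒≡label e)
  ≋⇒≡label (≋-trans e e′)                    = trans (≋⇒≡label e) (≋⇒≡label e′)
  ≋⇒≡label (parˡ-any _ _ _ _ _ _)            = refl
  ≋⇒≡label (parʳ-any _ _ _ _ _ _)            = refl
  ≋⇒≡label (sync-parˡ _ _ (!? _) _ _ _)      = refl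
  ≋⇒≡label (sync-parʳ _ _ (?! _) _ _ _)      = refl
  ≋⇒≡label (sumˡ-id _ _ _)                   = refl
  ≋⇒≡label (sumʳ-id _ _ _)                   = refl
  ≋⇒≡label (rec-id _ _ _)                    = refl
  ≋⇒≡label (res _ _ _ _ _ e)                 = ≋⇒≡label e
  ≋⇒≡label (rel f e)                         = cong (relabel f) (≋⇒≡label e)
  ≋⇒≡label (parˡ _ _ _ e)                    = ≋⇒≡label e
  ≋⇒≡label (parʳ _ _ _ e)                    = ≋⇒≡label e
  ≋⇒≡label (sync s t e e′) with ≋⇒≡label e | ≋⇒≡label e′
  ... | refl | refl                          = cong proj₁ (Sync-unique s t)

  ≋⇒≡shape : {χ : Der P ℓ P′} {ζ : Der Q ℓ′ Q′} → χ ≋ ζ → shape χ ≡ shape ζ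
  ≋⇒≡shape (≋-refl _ _)                      = refl
  ≋⇒≡shape (≋-sym e)                         = sym (≋⇒≡shape e)
  ≋⇒≡shape (≋-trans e e′)                    = trans (≋⇒≡shape e) (≋⇒≡shape e′)
  ≋⇒≡shape (parˡ-any _ _ _ _ _ _)            = refl
  ≋⇒≡shape (parʳ-any _ _ _ _ _ _)            = refl
  ≋⇒≡shape (sync-parˡ _ _ (!? _) _ _ _)      = refl
  ≋⇒≡shape (sync-parʳ _ _ (?! _) _ _ _)      = refl
  ≋⇒≡shape (sumˡ-id _ _ _)                   = refl
  ≋⇒≡shape (sumʳ-id _ _ _)                   = refl
  ≋⇒≡shape (rec-id _ _ _)                    = refl
  ≋⇒≡shape (res _ _ _ _ _ e)                 = ≋⇒≡shape e
  ≋⇒≡shape (rel _ e)                         = ≋⇒≡shape e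
  ≋⇒≡shape (parˡ _ _ _ e)                    = cong (λ x → node (just x) nothing) (≋⇒≡shape e)
  ≋⇒≡shape (parʳ _ _ _ e)                    = cong (λ x → node nothing (just x)) (≋⇒≡shape e)
  ≋⇒≡shape (sync s t e e′) with ≋⇒≡label e | ≋⇒≡label e′
  ... | refl | refl with Sync-unique s t
  ... | refl = cong₂ (λ x y → node (when (activeˡ s) x) (when (activeʳ s) y))
                     (≋⇒≡shape e) (≋⇒≡shape e′)

  ⌣⇒# : {χ : Der P ℓ P′} {ζ : Der Q ℓ′ Q′} → χ ⌣ ζ → shape χ # shape ζ
  ⌣⇒# (lr _ _ _ _)              = left just-nothing
  ⌣⇒# (rl _ _ _ _)              = left nothing-just
  ⌣⇒# (sr _ _ _ (!? _) _)       = left just-nothing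
  ⌣⇒# (sr _ _ _ (?? _) _)       = left just-nothing
  ⌣⇒# (sl _ _ _ (?! _) _)       = right just-nothing
  ⌣⇒# (sl _ _ _ (?? _) _)       = right just-nothing
  ⌣⇒# (sumˡ _ c)                = ⌣⇒# c
  ⌣⇒# (sumʳ _ c)                = ⌣⇒# c
  ⌣⇒# (parˡ _ _ _ c)            = left (just-just (⌣⇒# c))
  ⌣⇒# (parʳ _ _ _ c)            = right (just-just (⌣⇒# c))
  ⌣⇒# (l-s _ _ t c)             = left (just-#ᵐ-when (activeˡ t) (⌣⇒# c))
  ⌣⇒# (s-l _ s _ c)             = left (when-#ᵐ-just (activeˡ s) (⌣⇒# c))
  ⌣⇒# (r-s _ _ t c)             = right (just-#ᵐ-when (activeʳ t) (⌣⇒# c))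
  ⌣⇒# (s-r _ s _ c)             = right (when-#ᵐ-just (activeʳ s) (⌣⇒# c))
  ⌣⇒# (s-sˡ _ _ (!? _) t c)     = left (just-#ᵐ-when (activeˡ t) (⌣⇒# c))
  ⌣⇒# (s-sˡ _ _ (?? _) t c)     = left (just-#ᵐ-when (activeˡ t) (⌣⇒# c))
  ⌣⇒# (s-sʳ _ _ (?! _) t c)     = right (just-#ᵐ-when (activeʳ t) (⌣⇒# c))
  ⌣⇒# (s-sʳ _ _ (?? _) t c)     = right (just-#ᵐ-when (activeʳ t) (⌣⇒# c))
  ⌣⇒# (s-s (comm _) t c _)      = left (just-#ᵐ-when (activeˡ t) (⌣⇒# c))
  ⌣⇒# (s-s (!? _) t c _)        = left (just-#ᵐ-when (activeˡ t) (⌣⇒# c))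
  ⌣⇒# (s-s (?! _) t _ d)        = right (just-#ᵐ-when (activeʳ t) (⌣⇒# d))
  ⌣⇒# (s-s (?? _) t c _)        = left (just-#ᵐ-when (activeˡ t) (⌣⇒# c))
  ⌣⇒# (res _ _ _ _ _ c)         = ⌣⇒# c
  ⌣⇒# (rel _ c)                 = ⌣⇒# c
  ⌣⇒# (rec _ c)                 = ⌣⇒# c

lemma6 : {𝒜 ℬ 𝒞 : Set} (Δ : 𝒜 → ABC.Expr 𝒜 ℬ 𝒞) →
         (∀ A → ABC.Guarded 𝒜 ℬ 𝒞 (Δ A)) →
         ∀ {P ℓ P' Q ℓ' Q'}
           (χ : ABC.Semantics.Der 𝒜 ℬ 𝒞 Δ P ℓ P')
           (ζ : ABC.Semantics.Der 𝒜 ℬ 𝒞 Δ Q ℓ' Q') →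
         ABC.Semantics._⌣_ 𝒜 ℬ 𝒞 Δ χ ζ → ¬ ABC.Semantics._≋_ 𝒜 ℬ 𝒞 Δ χ ζ
lemma6 Δ _ _ _ χ⌣ζ χ≋ζ = #-irrefl (≋⇒≡shape Δ χ≋ζ) (⌣⇒# Δ χ⌣ζ)
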